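{- Let $n\ge1$ and let $\pi$ be any permutation of $\{0,1,\dots,n-1\}$. Then the words $u=0\,1\,\cdots\,(n-1)$ and $v=\pi(0)\,\pi(1)\,\cdots\,\pi(n-1)$ over the alphabet $\{0,1,\dots,n-1\}$ are cyclically equalizable.
   Context: Two words $x=x_0\cdots x_{N-1}$, $y$ of length $N$ are cyclically equivalent if $y=x_rx_{r+1}\cdots x_{N-1}x_0\cdots x_{r-1}$ for some integer $r$. Given words $w_1,w_2\in\Sigma^n$ with $w_i=a_{i,0}\cdots a_{i,n-1}$, a simultaneous insertion transforms each $w_i$ into $x_0a_{i,0}x_1a_{i,1}\cdots x_{n-1}a_{i,n-1}x_n$, where the words $x_0,\dots,x_n\in\Sigma^*$ are the same for both $i$. Two words of equal length are cyclically equalizable if some simultaneous insertion transforms them into cyclically equivalent words. -}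

module Defs where

open import Data.Nat using (ℕ; suc)
open import Data.List using (List; []; _∷_; _++_; take; drop)
open import Data.Vec using (Vec; []; _∷_; toList)
open import Data.Product using (∃; ∃-syntax; _×_)
open import Relation.Binary.PropositionalEquality using (_≡_)

-- Cyclic equivalence: y = x_r ... x_{N-1} x_0 ... x_{r-1} for some r.
-- (r ranges over ℕ; any integer r is equivalent mod N to some r with 0 ≤ r < N,
--  and drop r x ++ take r x = x for r ≥ N, so this is the same relation.)
CyclicallyEquivalent : {A : Set} → List A → List A → Set
CyclicallyEquivalent x y = ∃[ r ] (y ≡ drop r x ++ take r x)

insertWords : {A : Set} {n : ℕ} → Vec (List A) (suc n) → Vec A n → List A
insertWords (x ∷ []) [] = x
insertWords (x ∷ xs@(_ ∷ _)) (a ∷ w) = x ++ (a ∷ insertWords xs w)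

CyclicallyEqualizable : {A : Set} {n : ℕ} → Vec A n → Vec A n → Set
CyclicallyEqualizable {A} {n} w₁ w₂ =
  ∃[ xs ] CyclicallyEquivalent (insertWords {A} {n} xs w₁) (insertWords xs w₂)

{-# OPTIONS --safe #-}
-- Write f for π. Suppose words W₀, …, Wₙ are such that W_{i+1} arises from Wᵢ by replacing one
-- occurrence of the letter i by f i. Cutting every Wᵢ at that occurrence gives one insertion that
-- turns u into W₀ ⋯ Wₙ₋₁ E and v into W₁ ⋯ Wₙ E, for any word E; if Wₙ E = E W₀ the two results
-- are rotations of each other.
-- Such rows exist. Let leader c be the least element of the cycle of c, and depth c the least k
-- with fᵏ c = leader c. Each Wᵣ is a concatenation of n + 1 blocks of n cells; the letter c owns
-- cell leader c of block depth c, where Wᵣ shows c if r ≤ c and f c otherwise, and a cell ρ owned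
-- by nobody shows f ρ. Then W_{c+1} differs from W_c only in the cell of c, and for
-- E = f 0 ⋯ f (n - 1), Wₙ is E followed by the first n blocks of W₀, whose last block is E.
module Submission where

open import Defs
open import Data.Nat using (ℕ; _≥_)
open import Data.Fin using (Fin)
open import Data.Fin.Permutation using (Permutation′; _⟨$⟩ʳ_)
open import Data.Vec using (tabulate)

open import Level using (Level)
open import Function using (_∘_; id)
open import Function.Definitions using (Injective)
open import Data.Nat using (zero; suc; _+_; _*_; _≤_; _<_; z≤n; s≤s; s≤s⁻¹; _<?_; NonZero)
open import Data.Nat.Properties
  using (+-comm; _≤?_; ≤-refl; ≤-reflexive; ≤-trans; ≤-antisym; <⇒≤; <⇒≱; <⇒≢; ≮⇒≥; <-≤-trans; <-cmp;
         n≤0⇒n≡0; n<1+n; n≤1+n; m≤n+m; suc-injective; m≤n⇒∃[o]m+o≡n)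
  renaming (_≟_ to _ℕ≟_)
open import Data.Nat.DivMod using (_%_; _/_; m≡m%n+[m/n]*n; m%n<n)
open import Data.Nat.GeneralisedArithmetic using (iterate)
open import Data.Fin using (zero; suc; toℕ; fromℕ<)
open import Data.Fin.Properties
  using (toℕ-injective; toℕ<n; toℕ-fromℕ<; toℕ-inject; pigeonhole; any?; ¬∀⟶∃¬-smallest)
  renaming (_≟_ to _≟ᶠ_; suc-injective to sucᶠ-injective)
open import Data.Fin.Permutation using (_⟨$⟩ˡ_; inverseˡ; inverseʳ)
open import Data.List using (List; []; _∷_; _++_; [_]; concat; applyUpTo; length; take; drop; upTo)
import Data.List as List
open import Data.List.Properties
  using (++-assoc; ++-identityʳ; concat-++; applyUpTo-∷ʳ; map-upTo; map-cong; tabulate-cong)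
open import Data.Vec using (Vec)
open import Data.Product using (∃; ∃₂; ∃-syntax; _×_; _,_; proj₁; proj₂)
open import Data.Empty using (⊥-elim)
open import Relation.Nullary using (Dec; yes; no)
open import Relation.Nullary.Decidable using (map′; decidable-stable; _×-dec_)
open import Relation.Unary using (Pred; Decidable; ∁)
open import Relation.Unary.Properties using (∁?)
open import Relation.Binary.Definitions using (tri<; tri≈; tri>)
open import Relation.Binary.PropositionalEquality
  using (_≡_; _≢_; refl; sym; trans; cong; cong₂; subst; subst₂; module ≡-Reasoning)

private
  variable
    a b : Level
    A : Set a

Replaced : A → A → List A → List A → Set _
Replaced p q xs ys = ∃₂ λ pre post → xs ≡ pre ++ p ∷ post × ys ≡ pre ++ q ∷ post

tabulate-Replaced : ∀ {m} (F G : Fin m → A) i → (∀ j → j ≢ i → F j ≡ G j) →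
                    Replaced (F i) (G i) (List.tabulate F) (List.tabulate G)
tabulate-Replaced F G zero agree =
  [] , List.tabulate (F ∘ suc) , refl , cong (G zero ∷_) (tabulate-cong λ j → sym (agree (suc j) λ ()))
tabulate-Replaced F G (suc i) agree
  with tabulate-Replaced (F ∘ suc) (G ∘ suc) i (λ j j≢i → agree (suc j) (j≢i ∘ sucᶠ-injective))
... | pre , post , eqF , eqG =
  F zero ∷ pre , post , cong (F zero ∷_) eqF , cong₂ _∷_ (sym (agree zero λ ())) eqG

applyUpTo-cong : ∀ {F G : ℕ → A} → (∀ k → F k ≡ G k) → ∀ m → applyUpTo F m ≡ applyUpTo G m
applyUpTo-cong {F = F} {G} F≗G m = begin
  applyUpTo F m        ≡⟨ map-upTo F m ⟨
  List.map F (upTo m)  ≡⟨ map-cong F≗G (upTo m) ⟩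
  List.map G (upTo m)  ≡⟨ map-upTo G m ⟩
  applyUpTo G m        ∎
  where open ≡-Reasoning

applyUpTo-Replaced : ∀ (F G : ℕ → A) {k} m → k < m → (∀ j → j ≢ k → F j ≡ G j) →
                     Replaced (F k) (G k) (applyUpTo F m) (applyUpTo G m)
applyUpTo-Replaced F G {zero} (suc m) _ agree =
  [] , applyUpTo (F ∘ suc) m , refl , cong (G 0 ∷_) (applyUpTo-cong (λ j → sym (agree (suc j) λ ())) m)
applyUpTo-Replaced F G {suc k} (suc m) (s≤s k<m) agree
  with applyUpTo-Replaced (F ∘ suc) (G ∘ suc) m k<m (λ j j≢k → agree (suc j) (j≢k ∘ suc-injective))
... | pre , post , eqF , eqG =
  F 0 ∷ pre , post , cong (F 0 ∷_) eqF , cong₂ _∷_ (sym (agree 0 λ ())) eqG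

concat-Replaced : ∀ {p q : A} {xs ys xss yss} →
                  Replaced xs ys xss yss → Replaced p q xs ys → Replaced p q (concat xss) (concat yss)
concat-Replaced {p = p} {q} {xs} {ys} (pre , post , refl , refl) (pre′ , post′ , refl , refl) =
  concat pre ++ pre′ , post′ ++ concat post , splice p , splice q
  where
  splice : ∀ r → concat (pre ++ (pre′ ++ r ∷ post′) ∷ post)
                 ≡ (concat pre ++ pre′) ++ r ∷ post′ ++ concat post
  splice r = begin
    concat (pre ++ (pre′ ++ r ∷ post′) ∷ post)         ≡⟨ concat-++ pre _ ⟨
    concat pre ++ (pre′ ++ r ∷ post′) ++ concat post  ≡⟨ cong (concat pre ++_) (++-assoc pre′ _ _) ⟩
    concat pre ++ pre′ ++ r ∷ post′ ++ concat post    ≡⟨ ++-assoc (concat pre) pre′ _ ⟨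
    (concat pre ++ pre′) ++ r ∷ post′ ++ concat post  ∎
    where open ≡-Reasoning

concat-applyUpTo-suc : ∀ (F : ℕ → List A) m → concat (applyUpTo F (suc m)) ≡ concat (applyUpTo F m) ++ F m
concat-applyUpTo-suc F m = begin
  concat (applyUpTo F (suc m))           ≡⟨ cong concat (applyUpTo-∷ʳ F m) ⟨
  concat (applyUpTo F m ++ [ F m ])      ≡⟨ concat-++ (applyUpTo F m) [ F m ] ⟨
  concat (applyUpTo F m) ++ F m ++ []    ≡⟨ cong (concat (applyUpTo F m) ++_) (++-identityʳ (F m)) ⟩
  concat (applyUpTo F m) ++ F m          ∎
  where open ≡-Reasoning

drop-length-++ : ∀ (xs ys : List A) → drop (length xs) (xs ++ ys) ≡ ys
drop-length-++ []       ys = refl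
drop-length-++ (x ∷ xs) ys = drop-length-++ xs ys

take-length-++ : ∀ (xs ys : List A) → take (length xs) (xs ++ ys) ≡ xs
take-length-++ []       ys = refl
take-length-++ (x ∷ xs) ys = cong (x ∷_) (take-length-++ xs ys)

++-cyclicallyEquivalent : ∀ {A : Set} (xs ys : List A) → CyclicallyEquivalent (xs ++ ys) (ys ++ xs)
++-cyclicallyEquivalent xs ys =
  length xs , sym (cong₂ _++_ (drop-length-++ xs ys) (take-length-++ xs ys))

module _ {A : Set} where

  prependHead : ∀ {n} → List A → Vec (List A) (suc n) → Vec (List A) (suc n)
  prependHead p (x Vec.∷ xs) = (p ++ x) Vec.∷ xs

  insertWords-prependHead : ∀ {n} p (xs : Vec (List A) (suc n)) (w : Vec A n) →
                            insertWords (prependHead p xs) w ≡ p ++ insertWords xs w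
  insertWords-prependHead p (x Vec.∷ Vec.[])    Vec.[]      = refl
  insertWords-prependHead p (x Vec.∷ _ Vec.∷ _) (_ Vec.∷ _) = ++-assoc p x _

  insertWords-∷ : ∀ {n} x (xs : Vec (List A) (suc n)) a w →
                  insertWords (x Vec.∷ xs) (a Vec.∷ w) ≡ x ++ a ∷ insertWords xs w
  insertWords-∷ x (_ Vec.∷ _) a w = refl

  insertWords-telescope : ∀ {n} (u v : Fin n → A) (W : ℕ → List A) (T : List A) →
    (∀ i → Replaced (u i) (v i) (W (toℕ i)) (W (suc (toℕ i)))) →
    ∃[ xs ] insertWords xs (tabulate u) ≡ concat (applyUpTo W n) ++ T
          × insertWords xs (tabulate v) ≡ concat (applyUpTo (W ∘ suc) n) ++ T
  insertWords-telescope {zero} u v W T steps = T Vec.∷ Vec.[] , refl , refl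
  insertWords-telescope {suc n} u v W T steps
    with steps zero | insertWords-telescope (u ∘ suc) (v ∘ suc) (W ∘ suc) T (steps ∘ suc)
  ... | pre , post , W₀≡ , W₁≡ | xs , eqU , eqV = pre Vec.∷ prependHead post xs , splice W₀≡ eqU , splice W₁≡ eqV
    where
    splice : ∀ {x Wₓ R w} → Wₓ ≡ pre ++ x ∷ post → insertWords xs w ≡ R ++ T →
             insertWords (pre Vec.∷ prependHead post xs) (x Vec.∷ w) ≡ (Wₓ ++ R) ++ T
    splice {x} {Wₓ} {R} {w} refl eq = begin
      insertWords (pre Vec.∷ prependHead post xs) (x Vec.∷ w)
        ≡⟨ insertWords-∷ pre (prependHead post xs) x w ⟩
      pre ++ x ∷ insertWords (prependHead post xs) w
        ≡⟨ cong (λ z → pre ++ x ∷ z) (insertWords-prependHead post xs w) ⟩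
      pre ++ x ∷ post ++ insertWords xs w
        ≡⟨ cong (λ z → pre ++ x ∷ post ++ z) eq ⟩
      pre ++ x ∷ post ++ R ++ T
        ≡⟨ ++-assoc pre (x ∷ post) (R ++ T) ⟨
      Wₓ ++ R ++ T
        ≡⟨ ++-assoc Wₓ R T ⟨
      (Wₓ ++ R) ++ T
        ∎
      where open ≡-Reasoning

  cyclicallyEqualizable-by-rows : ∀ {n} (u v : Fin (suc n) → A) (W : ℕ → List A) (E : List A) →
    (∀ i → Replaced (u i) (v i) (W (toℕ i)) (W (suc (toℕ i)))) →
    W (suc n) ++ E ≡ E ++ W 0 →
    CyclicallyEqualizable (tabulate u) (tabulate v)
  cyclicallyEqualizable-by-rows {n} u v W E steps wrap
    with insertWords-telescope u v W E steps
  ... | xs , eqU , eqV = xs , subst₂ CyclicallyEquivalent (sym U≡) (sym V≡) (++-cyclicallyEquivalent (W 0) (M ++ E))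
    where
    open ≡-Reasoning
    M : List A
    M = concat (applyUpTo (W ∘ suc) n)
    U≡ : insertWords xs (tabulate u) ≡ W 0 ++ M ++ E
    U≡ = trans eqU (++-assoc (W 0) M E)
    V≡ : insertWords xs (tabulate v) ≡ (M ++ E) ++ W 0
    V≡ = begin
      insertWords xs (tabulate v)                     ≡⟨ eqV ⟩
      concat (applyUpTo (W ∘ suc) (suc n)) ++ E       ≡⟨ cong (_++ E) (concat-applyUpTo-suc (W ∘ suc) n) ⟩
      (M ++ W (suc n)) ++ E                           ≡⟨ ++-assoc M (W (suc n)) E ⟩
      M ++ W (suc n) ++ E                             ≡⟨ cong (M ++_) wrap ⟩
      M ++ E ++ W 0                                   ≡⟨ ++-assoc M E (W 0) ⟨
      (M ++ E) ++ W 0                                 ∎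

least-witness : ∀ {n} {P : Pred (Fin n) b} → Decidable P → ∃ P → ∃ λ x → P x × (∀ {y} → P y → toℕ x ≤ toℕ y)
least-witness {n = n} {P = P} P? (y , Py) with ¬∀⟶∃¬-smallest n (∁ P) (∁? P?) (λ ∀¬P → ∀¬P y Py)
... | x , ¬¬Px , below = x , decidable-stable (P? x) ¬¬Px , λ {z} Pz → ≮⇒≥ λ z<x →
  below (fromℕ< z<x) (subst P (sym (toℕ-injective (trans (toℕ-inject (fromℕ< z<x)) (toℕ-fromℕ< z<x)))) Pz)

module _ (h : A → A) where

  iterate-+ : ∀ x m k → iterate h x (m + k) ≡ iterate h (iterate h x m) k
  iterate-+ x zero    k = refl
  iterate-+ x (suc m) k = iterate-+ (h x) m k

  iterate-injective : Injective _≡_ _≡_ h → ∀ k {x y} → iterate h x k ≡ iterate h y k → x ≡ y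
  iterate-injective inj zero    eq = eq
  iterate-injective inj (suc k) eq = inj (iterate-injective inj k eq)

  iterate-multiple : ∀ {x P} → iterate h x P ≡ x → ∀ q → iterate h x (q * P) ≡ x
  iterate-multiple         hᴾx≡x zero    = refl
  iterate-multiple {x} {P} hᴾx≡x (suc q) = begin
    iterate h x (P + q * P)            ≡⟨ iterate-+ x P (q * P) ⟩
    iterate h (iterate h x P) (q * P)  ≡⟨ cong (λ y → iterate h y (q * P)) hᴾx≡x ⟩
    iterate h x (q * P)                ≡⟨ iterate-multiple hᴾx≡x q ⟩
    x                                  ∎
    where open ≡-Reasoning

  iterate-% : ∀ {x} P .{{_ : NonZero P}} → iterate h x P ≡ x → ∀ k → iterate h x (k % P) ≡ iterate h x k
  iterate-% {x} P hᴾx≡x k = sym (begin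
    iterate h x k                                  ≡⟨ cong (iterate h x) (trans (m≡m%n+[m/n]*n k P) (+-comm (k % P) _)) ⟩
    iterate h x (k / P * P + k % P)                ≡⟨ iterate-+ x (k / P * P) (k % P) ⟩
    iterate h (iterate h x (k / P * P)) (k % P)    ≡⟨ cong (λ y → iterate h y (k % P)) (iterate-multiple hᴾx≡x (k / P)) ⟩
    iterate h x (k % P)                            ∎)
    where open ≡-Reasoning

iterate-periodic : ∀ {n} {h : Fin n → Fin n} → Injective _≡_ _≡_ h →
                   ∀ x → ∃ λ p → p < n × iterate h x (suc p) ≡ x
iterate-periodic {n} {h} inj x with pigeonhole (n<1+n n) (λ (k : Fin (suc n)) → iterate h x (toℕ k))
... | i , j , i<j , hⁱx≡hʲx with m≤n⇒∃[o]m+o≡n i<j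
... | p , i+1+p≡j = p , p<n , iterate-injective h inj (toℕ i) (begin
  iterate h (iterate h x (suc p)) (toℕ i)   ≡⟨ iterate-+ h x (suc p) (toℕ i) ⟨
  iterate h x (suc p + toℕ i)               ≡⟨ cong (iterate h x) (trans (cong suc (+-comm p (toℕ i))) i+1+p≡j) ⟩
  iterate h x (toℕ j)                       ≡⟨ hⁱx≡hʲx ⟨
  iterate h x (toℕ i)                       ∎)
  where
  open ≡-Reasoning
  p<n : p < n
  p<n = ≤-trans (s≤s (m≤n+m p (toℕ i))) (≤-trans (≤-reflexive i+1+p≡j) (s≤s⁻¹ (toℕ<n j)))

module Cycles {n} (π : Permutation′ n) where

  f g : Fin n → Fin n
  f = π ⟨$⟩ʳ_
  g = π ⟨$⟩ˡ_

  f-injective : Injective _≡_ _≡_ f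
  f-injective {x} {y} fx≡fy = trans (sym (inverseˡ π)) (trans (cong g fx≡fy) (inverseˡ π))

  InOrbit : Fin n → Fin n → Set
  InOrbit x y = ∃[ k ] iterate f x k ≡ y

  inOrbit-bounded : ∀ {x y} → InOrbit x y → ∃ λ (k : Fin n) → iterate f x (toℕ k) ≡ y
  inOrbit-bounded {x} (k , fᵏx≡y) with iterate-periodic f-injective x
  ... | p , p<n , cycle =
    fromℕ< k%<n , trans (cong (iterate f x) (toℕ-fromℕ< k%<n)) (trans (iterate-% f (suc p) cycle k) fᵏx≡y)
    where
    k%<n : k % suc p < n
    k%<n = <-≤-trans (m%n<n k (suc p)) p<n

  inOrbit? : ∀ x → Decidable (InOrbit x)
  inOrbit? x y = map′ (λ (k , eq) → toℕ k , eq) inOrbit-bounded (any? λ k → iterate f x (toℕ k) ≟ᶠ y)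

  inOrbit-f⁺ : ∀ {x y} → InOrbit (f x) y → InOrbit x y
  inOrbit-f⁺ (k , eq) = suc k , eq

  inOrbit-f⁻ : ∀ {x y} → InOrbit x y → InOrbit (f x) y
  inOrbit-f⁻ {x} (k , fᵏx≡y) with iterate-periodic f-injective x
  ... | p , _ , cycle = p + k , trans (trans (iterate-+ f x (suc p) k) (cong (λ z → iterate f z k) cycle)) fᵏx≡y

  least-inOrbit : ∀ x → ∃ λ ℓ → InOrbit x ℓ × (∀ {y} → InOrbit x y → toℕ ℓ ≤ toℕ y)
  least-inOrbit x = least-witness (inOrbit? x) (x , 0 , refl)

  opaque
    leader : Fin n → Fin n
    leader x = proj₁ (least-inOrbit x)

    inOrbit-leader : ∀ x → InOrbit x (leader x)
    inOrbit-leader x = proj₁ (proj₂ (least-inOrbit x))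

    leader-minimal : ∀ {x y} → InOrbit x y → toℕ (leader x) ≤ toℕ y
    leader-minimal {x} = proj₂ (proj₂ (least-inOrbit x))

  leader-f : ∀ x → leader (f x) ≡ leader x
  leader-f x = toℕ-injective (≤-antisym (leader-minimal (inOrbit-f⁻ (inOrbit-leader x)))
                                        (leader-minimal (inOrbit-f⁺ (inOrbit-leader (f x)))))

  leader-g : ∀ x → leader (g x) ≡ leader x
  leader-g x = trans (sym (leader-f (g x))) (cong leader (inverseʳ π))

  opaque
    least-depth : ∀ x → ∃ λ (d : Fin n) → iterate f x (toℕ d) ≡ leader x
                          × (∀ {k : Fin n} → iterate f x (toℕ k) ≡ leader x → toℕ d ≤ toℕ k)
    least-depth x = least-witness (λ k → iterate f x (toℕ k) ≟ᶠ leader x) (inOrbit-bounded (inOrbit-leader x))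

    depth : Fin n → ℕ
    depth x = toℕ (proj₁ (least-depth x))

    depth<n : ∀ x → depth x < n
    depth<n x = toℕ<n (proj₁ (least-depth x))

    iterate-depth : ∀ x → iterate f x (depth x) ≡ leader x
    iterate-depth x = proj₁ (proj₂ (least-depth x))

    depth-minimal : ∀ x k → iterate f x k ≡ leader x → depth x ≤ k
    depth-minimal x k fᵏx≡ℓ with k <? n
    ... | yes k<n = subst (depth x ≤_) (toℕ-fromℕ< k<n)
                      (proj₂ (proj₂ (least-depth x)) (trans (cong (iterate f x) (toℕ-fromℕ< k<n)) fᵏx≡ℓ))
    ... | no  k≮n = <⇒≤ (<-≤-trans (depth<n x) (≮⇒≥ k≮n))

  depth≡0⇒leader : ∀ {x} → depth x ≡ 0 → x ≡ leader x
  depth≡0⇒leader {x} d≡0 = subst (λ k → iterate f x k ≡ leader x) d≡0 (iterate-depth x)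

  leader⇒depth≡0 : ∀ {x} → x ≡ leader x → depth x ≡ 0
  leader⇒depth≡0 {x} x≡ℓ = n≤0⇒n≡0 (depth-minimal x 0 x≡ℓ)

  depth-f : ∀ {x} → x ≢ leader x → depth x ≡ suc (depth (f x))
  depth-f {x} x≢ℓ = ≤-antisym (depth-minimal x _ (trans (iterate-depth (f x)) (leader-f x)))
                              (below (depth x) (iterate-depth x))
    where
    below : ∀ k → iterate f x k ≡ leader x → suc (depth (f x)) ≤ k
    below zero    x≡ℓ  = ⊥-elim (x≢ℓ x≡ℓ)
    below (suc k) fᵏx≡ℓ = s≤s (depth-minimal (f x) k (trans fᵏx≡ℓ (sym (leader-f x))))

  leader-depth-injective : ∀ {x y} → leader x ≡ leader y → depth x ≡ depth y → x ≡ y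
  leader-depth-injective {x} {y} ℓ≡ d≡ = iterate-injective f f-injective (depth x) (begin
    iterate f x (depth x) ≡⟨ iterate-depth x ⟩
    leader x              ≡⟨ ℓ≡ ⟩
    leader y              ≡⟨ iterate-depth y ⟨
    iterate f y (depth y) ≡⟨ cong (iterate f y) d≡ ⟨
    iterate f y (depth x) ∎)
    where open ≡-Reasoning

module Rows {n} (π : Permutation′ n) where

  open Cycles π

  Occupies : Fin n → Fin n → ℕ → Set
  Occupies c ρ k = leader c ≡ ρ × depth c ≡ k

  occupant? : ∀ ρ k → Dec (∃ λ c → Occupies c ρ k)
  occupant? ρ k = any? λ c → (leader c ≟ᶠ ρ) ×-dec (depth c ℕ≟ k)

  occupant-unique : ∀ {c c′ ρ k} → Occupies c ρ k → Occupies c′ ρ k → c ≡ c′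
  occupant-unique (ℓ≡ , d≡) (ℓ′≡ , d′≡) = leader-depth-injective (trans ℓ≡ (sym ℓ′≡)) (trans d≡ (sym d′≡))

  occupies-f : ∀ {c ρ k} → Occupies c ρ (suc k) → Occupies (f c) ρ k
  occupies-f {c} (ℓ≡ , d≡) = trans (leader-f c) ℓ≡ , suc-injective (trans (sym (depth-f c≢ℓ)) d≡)
    where
    c≢ℓ : c ≢ leader c
    c≢ℓ c≡ℓ with () ← trans (sym (leader⇒depth≡0 c≡ℓ)) d≡

  occupies-g : ∀ {c ρ k} → Occupies c ρ k → g c ≢ ρ → Occupies (g c) ρ (suc k)
  occupies-g {c} {ρ} (ℓ≡ , d≡) gc≢ρ =
    ℓg≡ , trans (depth-f gc≢ℓ) (cong suc (trans (cong depth (inverseʳ π)) d≡))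
    where
    ℓg≡ : leader (g c) ≡ ρ
    ℓg≡ = trans (leader-g c) ℓ≡
    gc≢ℓ : g c ≢ leader (g c)
    gc≢ℓ gc≡ℓ = gc≢ρ (trans gc≡ℓ ℓg≡)

  letterAt : ℕ → Fin n → Fin n
  letterAt r c with r ≤? toℕ c
  ... | yes _ = c
  ... | no  _ = f c

  letterAt-before : ∀ {r c} → r ≤ toℕ c → letterAt r c ≡ c
  letterAt-before {r} {c} r≤c with r ≤? toℕ c
  ... | yes _   = refl
  ... | no  r≰c = ⊥-elim (r≰c r≤c)

  letterAt-after : ∀ {r c} → toℕ c < r → letterAt r c ≡ f c
  letterAt-after {r} {c} c<r with r ≤? toℕ c
  ... | yes r≤c = ⊥-elim (<⇒≱ c<r r≤c)
  ... | no  _   = refl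

  letterAt-stable : ∀ {r c} → toℕ c ≢ r → letterAt r c ≡ letterAt (suc r) c
  letterAt-stable {r} {c} c≢r with <-cmp (toℕ c) r
  ... | tri< c<r _ _ = trans (letterAt-after c<r) (sym (letterAt-after (≤-trans c<r (n≤1+n r))))
  ... | tri≈ _ c≡r _ = ⊥-elim (c≢r c≡r)
  ... | tri> _ _ r<c = trans (letterAt-before (<⇒≤ r<c)) (sym (letterAt-before r<c))

  cell : Fin n → ℕ → ℕ → Fin n
  cell ρ k r with occupant? ρ k
  ... | yes (c , _) = letterAt r c
  ... | no  _       = f ρ

  cell-occupied : ∀ {c ρ k} r → Occupies c ρ k → cell ρ k r ≡ letterAt r c
  cell-occupied {c} {ρ} {k} r occ with occupant? ρ k
  ... | yes (c′ , occ′) = cong (letterAt r) (occupant-unique occ′ occ)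
  ... | no  vacant      = ⊥-elim (vacant (c , occ))

  cell-stable : ∀ ρ k r → (∀ {c} → Occupies c ρ k → toℕ c ≢ r) → cell ρ k r ≡ cell ρ k (suc r)
  cell-stable ρ k r untouched with occupant? ρ k
  ... | yes (c , occ) = letterAt-stable (untouched occ)
  ... | no  _         = refl

  cell-first-final : ∀ ρ → cell ρ 0 n ≡ f ρ
  cell-first-final ρ with occupant? ρ 0
  ... | yes (c , ℓ≡ , d≡) = trans (letterAt-after (toℕ<n c)) (cong f (trans (depth≡0⇒leader d≡) ℓ≡))
  ... | no  _             = refl

  cell-last-initial : ∀ ρ → cell ρ n 0 ≡ f ρ
  cell-last-initial ρ with occupant? ρ n
  ... | yes (c , _ , d≡) = ⊥-elim (<⇒≢ (depth<n c) d≡)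
  ... | no  _            = refl

  cell-shift : ∀ ρ k → cell ρ (suc k) n ≡ cell ρ k 0
  cell-shift ρ k with occupant? ρ (suc k)
  ... | yes (c , occ) = trans (letterAt-after (toℕ<n c))
                              (sym (trans (cell-occupied 0 (occupies-f occ)) (letterAt-before z≤n)))
  ... | no  vacant with occupant? ρ k
  ...   | no  _          = refl
  ...   | yes (c , occ) with g c ≟ᶠ ρ
  ...     | yes gc≡ρ = trans (cong f (sym gc≡ρ)) (inverseʳ π)
  ...     | no  gc≢ρ = ⊥-elim (vacant (g c , occupies-g occ gc≢ρ))

  block : ℕ → ℕ → List (Fin n)
  block r k = List.tabulate λ ρ → cell ρ k r

  row : ℕ → List (Fin n)
  row r = concat (applyUpTo (block r) (suc n))

  row-step : ∀ i → Replaced i (f i) (row (toℕ i)) (row (suc (toℕ i)))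
  row-step i = concat-Replaced
    (applyUpTo-Replaced (block (toℕ i)) (block (suc (toℕ i))) (suc n) (s≤s (<⇒≤ (depth<n i))) other-block)
    (subst₂ (λ p q → Replaced p q (block (toℕ i) (depth i)) (block (suc (toℕ i)) (depth i)))
            (trans (cell-occupied (toℕ i) (refl , refl)) (letterAt-before ≤-refl))
            (trans (cell-occupied (suc (toℕ i)) (refl , refl)) (letterAt-after ≤-refl))
            (tabulate-Replaced _ _ (leader i) other-lane))
    where
    only-i : ∀ {c ρ k} → Occupies c ρ k → toℕ c ≡ toℕ i → leader i ≡ ρ × depth i ≡ k
    only-i occ c≡i with refl ← toℕ-injective c≡i = occ
    other-block : ∀ k → k ≢ depth i → block (toℕ i) k ≡ block (suc (toℕ i)) k
    other-block k k≢d =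
      tabulate-cong λ ρ → cell-stable ρ k (toℕ i) λ occ c≡i → k≢d (sym (proj₂ (only-i occ c≡i)))
    other-lane : ∀ ρ → ρ ≢ leader i → cell ρ (depth i) (toℕ i) ≡ cell ρ (depth i) (suc (toℕ i))
    other-lane ρ ρ≢ℓ = cell-stable ρ (depth i) (toℕ i) λ occ c≡i → ρ≢ℓ (sym (proj₁ (only-i occ c≡i)))

  row-wrap : row n ++ List.tabulate f ≡ List.tabulate f ++ row 0
  row-wrap = begin
    (block n 0 ++ concat (applyUpTo (block n ∘ suc) n)) ++ E
      ≡⟨ cong₂ (λ B Bs → (B ++ concat Bs) ++ E) (tabulate-cong cell-first-final)
               (applyUpTo-cong (λ k → tabulate-cong λ ρ → cell-shift ρ k) n) ⟩
    (E ++ M) ++ E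
      ≡⟨ ++-assoc E M E ⟩
    E ++ M ++ E
      ≡⟨ cong (λ B → E ++ M ++ B) (tabulate-cong cell-last-initial) ⟨
    E ++ M ++ block 0 n
      ≡⟨ cong (E ++_) (concat-applyUpTo-suc (block 0) n) ⟨
    E ++ row 0
      ∎
    where
    open ≡-Reasoning
    E M : List (Fin n)
    E = List.tabulate f
    M = concat (applyUpTo (block 0) n)

theorem5 : (n : ℕ) → n ≥ 1 → (π : Permutation′ n) →
    CyclicallyEqualizable (tabulate {n = n} (λ (i : Fin n) → i)) (tabulate (λ i → π ⟨$⟩ʳ i))
theorem5 (suc n) _ π =
  cyclicallyEqualizable-by-rows id (π ⟨$⟩ʳ_) row (List.tabulate (π ⟨$⟩ʳ_)) row-step row-wrap
  where open Rows π
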